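{- Let $n\ge1$ and let $h$ be an odd integer with $1\le h\le n-1$. Then \[ \sum_{r=0}^{h}(-1)^r2^{h-r}n^r\binom{n+r-h-1}{n-h-1}\left[{n\atop n-h+r}\right]=0. \]
   Context: $\left[{n\atop k}\right]$ denotes the Stirling cycle number (unsigned Stirling number of the first kind), the number of permutations of an $n$-element set with exactly $k$ cycles. -}

module Defs where

open import Data.Nat using (ℕ; zero; suc; _+_; _*_)
open import Data.Integer as ℤ using (ℤ)

-- Unsigned Stirling numbers of the first kind (Stirling cycle numbers)
-- [n k] = number of permutations of n elements with exactly k cycles,
-- via the standard recurrence [n+1, k+1] = n [n, k+1] + [n, k].
stirling1 : ℕ → ℕ → ℕ
stirling1 zero    zero    = 1
stirling1 zero    (suc k) = 0
stirling1 (suc n) zero    = 0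
stirling1 (suc n) (suc k) = n * stirling1 n (suc k) + stirling1 n k

sumTo : ℕ → (ℕ → ℤ) → ℤ
sumTo zero    f = f zero
sumTo (suc h) f = sumTo h f ℤ.+ f (suc h)

sign : ℕ → ℤ
sign zero    = ℤ.+ 1
sign (suc r) = ℤ.- sign r

module Submission where

-- Put j = n - 1 - h. By the binomial theorem the sum is the coefficient of X^j in
--   Σ_k 2^(n-1-k) [n, k+1] (X - n)^k.
-- The homogenised generating function Σ_k [N, k] t^(N-k) z^k = z (z + t) ⋯ (z + (N-1) t),
-- divided by z = X - n and taken at t = 2, turns this polynomial into ∏_{i=1}^{n-1} (X - n + 2i).
-- Its roots are symmetric about 0, so it is even or odd with n - 1, and its coefficient of X^j
-- vanishes when j and n - 1 = h + j have opposite parity, that is, when h is odd.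

open import Defs
open import Data.Nat using (ℕ; zero; suc; _+_; _*_; _∸_; _^_; _≤_; _<_; z≤n; s≤s)
open import Data.Nat.Combinatorics using (_C_; nCn≡1; nCk+nC[k+1]≡[n+1]C[k+1])
import Data.Nat.Properties as ℕ
import Data.Nat.Tactic.RingSolver as ℕ-Solver
open import Data.Product using (∃; _,_)
open import Data.Integer using (ℤ; +_; -[1+_]; -_; 0ℤ; 1ℤ; -1ℤ) renaming (_+_ to _+ℤ_; _*_ to _*ℤ_; _^_ to _^ℤ_)
import Data.Integer.Properties as ℤ
open import Data.Integer.Tactic.RingSolver using (solve-∀)
open import Relation.Binary.PropositionalEquality using (_≡_; _≗_; refl; sym; trans; cong; cong₂; module ≡-Reasoning)
open ≡-Reasoning

sumTo-cong : ∀ L {f g : ℕ → ℤ} → (∀ k → k ≤ L → f k ≡ g k) → sumTo L f ≡ sumTo L g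
sumTo-cong zero    f≡g = f≡g 0 z≤n
sumTo-cong (suc L) f≡g =
  cong₂ _+ℤ_ (sumTo-cong L (λ k k≤L → f≡g k (ℕ.m≤n⇒m≤1+n k≤L))) (f≡g (suc L) ℕ.≤-refl)

sumTo-+ : ∀ L (f g : ℕ → ℤ) → sumTo L (λ k → f k +ℤ g k) ≡ sumTo L f +ℤ sumTo L g
sumTo-+ zero    f g = refl
sumTo-+ (suc L) f g = trans (cong (_+ℤ (f (suc L) +ℤ g (suc L))) (sumTo-+ L f g))
                            (interchange (sumTo L f) (sumTo L g) (f (suc L)) (g (suc L)))
  where
  interchange : ∀ a b c d → (a +ℤ b) +ℤ (c +ℤ d) ≡ (a +ℤ c) +ℤ (b +ℤ d)
  interchange = solve-∀

sumTo-*ˡ : ∀ L c (f : ℕ → ℤ) → sumTo L (λ k → c *ℤ f k) ≡ c *ℤ sumTo L f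
sumTo-*ˡ zero    c f = refl
sumTo-*ˡ (suc L) c f = trans (cong (_+ℤ c *ℤ f (suc L)) (sumTo-*ˡ L c f)) (sym (ℤ.*-distribˡ-+ c _ _))

sumTo-suc : ∀ L (f : ℕ → ℤ) → sumTo (suc L) f ≡ f 0 +ℤ sumTo L (λ k → f (suc k))
sumTo-suc zero    f = refl
sumTo-suc (suc L) f = trans (cong (_+ℤ f (2 + L)) (sumTo-suc L f)) (ℤ.+-assoc (f 0) _ _)

sumTo-drop : ∀ j h (f : ℕ → ℤ) → (∀ k → k < j → f k ≡ 0ℤ) → sumTo (j + h) f ≡ sumTo h (λ r → f (j + r))
sumTo-drop zero    h f _     = refl
sumTo-drop (suc j) h f f<j≡0 = begin
  sumTo (suc (j + h)) f                   ≡⟨ sumTo-suc (j + h) f ⟩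
  f 0 +ℤ sumTo (j + h) (λ k → f (suc k))  ≡⟨ cong₂ _+ℤ_ (f<j≡0 0 (s≤s z≤n))
                                                         (sumTo-drop j h _ (λ k k<j → f<j≡0 (suc k) (s≤s k<j))) ⟩
  0ℤ +ℤ sumTo h (λ r → f (suc j + r))     ≡⟨ ℤ.+-identityˡ _ ⟩
  sumTo h (λ r → f (suc j + r))           ∎

-- Polynomials over ℤ as coefficient sequences: p j is the coefficient of X^j.
Poly : Set
Poly = ℕ → ℤ

1ₚ : Poly
1ₚ zero    = 1ℤ
1ₚ (suc _) = 0ℤ

infixr 7 _*ₚ_ X+_·_
infixl 6 _+ₚ_
infixr 8 X+_^_

_*ₚ_ : ℤ → Poly → Poly
(s *ₚ p) j = s *ℤ p j

_+ₚ_ : Poly → Poly → Poly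
(p +ₚ q) j = p j +ℤ q j

X+_·_ : ℤ → Poly → Poly
(X+ c · p) zero    = c *ℤ p 0
(X+ c · p) (suc j) = p j +ℤ c *ℤ p (suc j)

X+_^_ : ℤ → ℕ → Poly
X+ c ^ zero  = 1ₚ
X+ c ^ suc i = X+ c · X+ c ^ i

reflect : Poly → Poly
reflect p j = sign j *ℤ p j

X+·-cong : ∀ c {p q} → p ≗ q → X+ c · p ≗ X+ c · q
X+·-cong c p≗q zero    = cong (c *ℤ_) (p≗q 0)
X+·-cong c p≗q (suc j) = cong₂ (λ x y → x +ℤ c *ℤ y) (p≗q j) (p≗q (suc j))

X+·-comm : ∀ c d p → X+ c · X+ d · p ≗ X+ d · X+ c · p
X+·-comm c d p zero = lemma c d (p 0)
  where
  lemma : ∀ c d x → c *ℤ (d *ℤ x) ≡ d *ℤ (c *ℤ x)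
  lemma = solve-∀
X+·-comm c d p (suc zero) = lemma c d (p 0) (p 1)
  where
  lemma : ∀ c d x y → d *ℤ x +ℤ c *ℤ (x +ℤ d *ℤ y) ≡ c *ℤ x +ℤ d *ℤ (x +ℤ c *ℤ y)
  lemma = solve-∀
X+·-comm c d p (suc (suc j)) = lemma c d (p j) (p (suc j)) (p (2 + j))
  where
  lemma : ∀ c d x y z → (x +ℤ d *ℤ y) +ℤ c *ℤ (y +ℤ d *ℤ z) ≡ (x +ℤ c *ℤ y) +ℤ d *ℤ (y +ℤ c *ℤ z)
  lemma = solve-∀

X+·-*ₚ : ∀ c s p → X+ c · s *ₚ p ≗ s *ₚ X+ c · p
X+·-*ₚ c s p zero = lemma c s (p 0)
  where
  lemma : ∀ c s x → c *ℤ (s *ℤ x) ≡ s *ℤ (c *ℤ x)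
  lemma = solve-∀
X+·-*ₚ c s p (suc j) = lemma c s (p j) (p (suc j))
  where
  lemma : ∀ c s x y → s *ℤ x +ℤ c *ℤ (s *ℤ y) ≡ s *ℤ (x +ℤ c *ℤ y)
  lemma = solve-∀

X+·-+ : ∀ a c p → X+ (a +ℤ c) · p ≗ X+ a · p +ₚ c *ₚ p
X+·-+ a c p zero = lemma a c (p 0)
  where
  lemma : ∀ a c x → (a +ℤ c) *ℤ x ≡ a *ℤ x +ℤ c *ℤ x
  lemma = solve-∀
X+·-+ a c p (suc j) = lemma a c (p j) (p (suc j))
  where
  lemma : ∀ a c x y → x +ℤ (a +ℤ c) *ℤ y ≡ (x +ℤ a *ℤ y) +ℤ c *ℤ y
  lemma = solve-∀

X+·-reflect : ∀ c p → reflect (X+ (- c) · p) ≗ -1ℤ *ₚ X+ c · reflect p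
X+·-reflect c p zero = lemma c (p 0)
  where
  lemma : ∀ c x → 1ℤ *ℤ (- c *ℤ x) ≡ -1ℤ *ℤ (c *ℤ (1ℤ *ℤ x))
  lemma = solve-∀
X+·-reflect c p (suc j) = lemma (sign j) c (p j) (p (suc j))
  where
  lemma : ∀ s c x y → (- s) *ℤ (x +ℤ - c *ℤ y) ≡ -1ℤ *ℤ (s *ℤ x +ℤ c *ℤ ((- s) *ℤ y))
  lemma = solve-∀

sumTo-X+· : ∀ L c (P : ℕ → Poly) →
            (λ j → sumTo L (λ k → (X+ c · P k) j)) ≗ X+ c · (λ j → sumTo L (λ k → P k j))
sumTo-X+· L c P zero    = sumTo-*ˡ L c (λ k → P k 0)
sumTo-X+· L c P (suc j) =
  trans (sumTo-+ L _ _) (cong (sumTo L (λ k → P k j) +ℤ_) (sumTo-*ˡ L c (λ k → P k (suc j))))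

X+^-coeff-above : ∀ c i j → i < j → (X+ c ^ i) j ≡ 0ℤ
X+^-coeff-above c zero    (suc j) _ = refl
X+^-coeff-above c (suc i) (suc j) (s≤s i<j)
  rewrite X+^-coeff-above c i j i<j | X+^-coeff-above c i (suc j) (ℕ.m≤n⇒m≤1+n i<j) | ℤ.*-zeroʳ c = refl

X+^-coeff-diag : ∀ c j → (X+ c ^ j) j ≡ 1ℤ
X+^-coeff-diag c zero = refl
X+^-coeff-diag c (suc j)
  rewrite X+^-coeff-diag c j | X+^-coeff-above c j (suc j) ℕ.≤-refl | ℤ.*-zeroʳ c = refl

X+^-coeff : ∀ c j r → (X+ c ^ (j + r)) j ≡ + ((j + r) C j) *ℤ c ^ℤ r
X+^-coeff c j zero rewrite ℕ.+-identityʳ j | nCn≡1 j = X+^-coeff-diag c j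
X+^-coeff c zero (suc r) = begin
  c *ℤ (X+ c ^ r) 0           ≡⟨ cong (c *ℤ_) (X+^-coeff c zero r) ⟩
  c *ℤ (1ℤ *ℤ c ^ℤ r)         ≡⟨ lemma c (c ^ℤ r) ⟩
  1ℤ *ℤ (c *ℤ c ^ℤ r)         ∎
  where
  lemma : ∀ c x → c *ℤ (1ℤ *ℤ x) ≡ 1ℤ *ℤ (c *ℤ x)
  lemma = solve-∀
X+^-coeff c (suc j) (suc r) = begin
  (X+ c ^ (j + suc r)) j +ℤ c *ℤ (X+ c ^ (j + suc r)) (suc j)
    ≡⟨ cong₂ (λ x y → x +ℤ c *ℤ y) (X+^-coeff c j (suc r))
             (trans (cong (λ i → (X+ c ^ i) (suc j)) (ℕ.+-suc j r)) (X+^-coeff c (suc j) r)) ⟩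
  + A *ℤ (c *ℤ c ^ℤ r) +ℤ c *ℤ (+ B *ℤ c ^ℤ r)
    ≡⟨ lemma (+ A) (+ B) c (c ^ℤ r) ⟩
  (+ A +ℤ + B) *ℤ (c *ℤ c ^ℤ r)
    ≡⟨ cong (_*ℤ (c *ℤ c ^ℤ r)) (sym (ℤ.pos-+ A B)) ⟩
  + (A + B) *ℤ (c *ℤ c ^ℤ r)
    ≡⟨ cong (λ m → + m *ℤ (c *ℤ c ^ℤ r)) pascal ⟩
  + ((suc j + suc r) C suc j) *ℤ (c *ℤ c ^ℤ r) ∎
  where
  A B : ℕ
  A = (j + suc r) C j
  B = (suc j + r) C suc j
  lemma : ∀ a b c x → a *ℤ (c *ℤ x) +ℤ c *ℤ (b *ℤ x) ≡ (a +ℤ b) *ℤ (c *ℤ x)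
  lemma = solve-∀
  pascal : A + B ≡ (suc j + suc r) C suc j
  pascal = trans (cong (λ i → A + i C suc j) (sym (ℕ.+-suc j r))) (nCk+nC[k+1]≡[n+1]C[k+1] (j + suc r) j)

sign-+ : ∀ m n → sign (m + n) ≡ sign m *ℤ sign n
sign-+ zero    n = sym (ℤ.*-identityˡ (sign n))
sign-+ (suc m) n = trans (cong -_ (sign-+ m n)) (ℤ.neg-distribˡ-* (sign m) (sign n))

sign-*-sign : ∀ j → sign j *ℤ sign j ≡ 1ℤ
sign-*-sign zero    = refl
sign-*-sign (suc j) = trans (lemma (sign j)) (sign-*-sign j)
  where
  lemma : ∀ s → (- s) *ℤ (- s) ≡ s *ℤ s
  lemma = solve-∀

sign-odd : ∀ k j → sign (2 * k + 1 + j) ≡ - sign j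
sign-odd k j = begin
  sign (2 * k + 1 + j)                     ≡⟨ sign-+ (2 * k + 1) j ⟩
  sign (k + (k + 0) + 1) *ℤ sign j         ≡⟨ cong (_*ℤ sign j) (sign-+ (k + (k + 0)) 1) ⟩
  sign (k + (k + 0)) *ℤ -1ℤ *ℤ sign j      ≡⟨ cong (λ s → s *ℤ -1ℤ *ℤ sign j) (sign-+ k (k + 0)) ⟩
  sign k *ℤ sign (k + 0) *ℤ -1ℤ *ℤ sign j  ≡⟨ cong (λ i → sign k *ℤ sign i *ℤ -1ℤ *ℤ sign j) (ℕ.+-identityʳ k) ⟩
  sign k *ℤ sign k *ℤ -1ℤ *ℤ sign j        ≡⟨ cong (λ s → s *ℤ -1ℤ *ℤ sign j) (sign-*-sign k) ⟩
  -1ℤ *ℤ sign j                            ≡⟨ ℤ.-1*i≡-i (sign j) ⟩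
  - sign j                                 ∎

[-m]^r≡sign[r]*m^r : ∀ m r → (- + m) ^ℤ r ≡ sign r *ℤ + (m ^ r)
[-m]^r≡sign[r]*m^r m zero    = refl
[-m]^r≡sign[r]*m^r m (suc r) = begin
  - + m *ℤ (- + m) ^ℤ r              ≡⟨ cong (- + m *ℤ_) ([-m]^r≡sign[r]*m^r m r) ⟩
  - + m *ℤ (sign r *ℤ + (m ^ r))     ≡⟨ lemma (+ m) (sign r) (+ (m ^ r)) ⟩
  (- sign r) *ℤ (+ m *ℤ + (m ^ r))   ≡⟨ cong ((- sign r) *ℤ_) (sym (ℤ.pos-* m (m ^ r))) ⟩
  (- sign r) *ℤ + (m * m ^ r)        ∎
  where
  lemma : ∀ m s x → - m *ℤ (s *ℤ x) ≡ (- s) *ℤ (m *ℤ x)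
  lemma = solve-∀

x≡-x⇒x≡0 : ∀ x → x ≡ - x → x ≡ 0ℤ
x≡-x⇒x≡0 (+ zero)  _ = refl
x≡-x⇒x≡0 (+ suc n) ()
x≡-x⇒x≡0 -[1+ n ] ()

reflect-parity-coeff : ∀ n j {p} → reflect p ≗ sign n *ₚ p → sign n ≡ - sign j → p j ≡ 0ℤ
reflect-parity-coeff n j {p} p-parity opposite = x≡-x⇒x≡0 (p j) (begin
  p j                              ≡⟨ lemma (sign j) (p j) (sign-*-sign j) ⟩
  sign j *ℤ (sign j *ℤ p j)        ≡⟨ cong (sign j *ℤ_) (trans (p-parity j) (cong (_*ℤ p j) opposite)) ⟩
  sign j *ℤ (- sign j *ℤ p j)      ≡⟨ lemma′ (sign j) (p j) ⟩
  - (sign j *ℤ sign j *ℤ p j)      ≡⟨ cong (λ s → - (s *ℤ p j)) (sign-*-sign j) ⟩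
  - (1ℤ *ℤ p j)                    ≡⟨ cong -_ (ℤ.*-identityˡ (p j)) ⟩
  - p j                            ∎)
  where
  lemma : ∀ s x → s *ℤ s ≡ 1ℤ → x ≡ s *ℤ (s *ℤ x)
  lemma s x s²≡1 = trans (sym (ℤ.*-identityˡ x)) (trans (cong (_*ℤ x) (sym s²≡1)) (ℤ.*-assoc s s x))
  lemma′ : ∀ s x → s *ℤ (- s *ℤ x) ≡ - (s *ℤ s *ℤ x)
  lemma′ = solve-∀

arithProd : ℕ → ℤ → ℕ → Poly
arithProd t a zero    = 1ₚ
arithProd t a (suc n) = X+ (a +ℤ + (t * suc n)) · arithProd t a n

a+t[n+2]≡[a+t]+t[n+1] : ∀ a t n → a +ℤ + (t * suc (suc n)) ≡ (a +ℤ + t) +ℤ + (t * suc n)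
a+t[n+2]≡[a+t]+t[n+1] a t n = begin
  a +ℤ + (t * suc (suc n))     ≡⟨ cong (λ m → a +ℤ + m) (ℕ.*-suc t (suc n)) ⟩
  a +ℤ + (t + t * suc n)       ≡⟨ cong (a +ℤ_) (ℤ.pos-+ t (t * suc n)) ⟩
  a +ℤ (+ t +ℤ + (t * suc n))  ≡⟨ ℤ.+-assoc a (+ t) (+ (t * suc n)) ⟨
  (a +ℤ + t) +ℤ + (t * suc n)  ∎

arithProd-peel : ∀ t a n → arithProd t a (suc n) ≗ X+ (a +ℤ + t) · arithProd t (a +ℤ + t) n
arithProd-peel t a zero j = cong (λ m → (X+ (a +ℤ + m) · 1ₚ) j) (ℕ.*-identityʳ t)
arithProd-peel t a (suc n) j = begin
  (X+ (a +ℤ + (t * suc (suc n))) · arithProd t a (suc n)) j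
    ≡⟨ X+·-cong _ (arithProd-peel t a n) j ⟩
  (X+ (a +ℤ + (t * suc (suc n))) · X+ (a +ℤ + t) · arithProd t (a +ℤ + t) n) j
    ≡⟨ X+·-comm _ _ _ j ⟩
  (X+ (a +ℤ + t) · X+ (a +ℤ + (t * suc (suc n))) · arithProd t (a +ℤ + t) n) j
    ≡⟨ cong (λ c → (X+ (a +ℤ + t) · X+ c · arithProd t (a +ℤ + t) n) j) (a+t[n+2]≡[a+t]+t[n+1] a t n) ⟩
  (X+ (a +ℤ + t) · arithProd t (a +ℤ + t) (suc n)) j ∎

arithProd-reflect : ∀ t a n → reflect (arithProd t (- (a +ℤ + (t * suc n))) n) ≗ sign n *ₚ arithProd t a n
arithProd-reflect t a zero zero    = refl
arithProd-reflect t a zero (suc j) = ℤ.*-zeroʳ (sign (suc j))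
arithProd-reflect t a (suc n) j = begin
  reflect (arithProd t (- (a +ℤ + (t * suc (suc n)))) (suc n)) j
    ≡⟨ cong (λ b → reflect (arithProd t (- b) (suc n)) j) (a+t[n+2]≡[a+t]+t[n+1] a t n) ⟩
  reflect (X+ (b +ℤ + (t * suc n)) · arithProd t b n) j
    ≡⟨ cong (λ c → reflect (X+ c · arithProd t b n) j) (lemma (a +ℤ + t) (+ (t * suc n))) ⟩
  reflect (X+ (- (a +ℤ + t)) · arithProd t b n) j
    ≡⟨ X+·-reflect (a +ℤ + t) _ j ⟩
  -1ℤ *ℤ (X+ (a +ℤ + t) · reflect (arithProd t b n)) j
    ≡⟨ cong (-1ℤ *ℤ_) (X+·-cong _ (arithProd-reflect t (a +ℤ + t) n) j) ⟩
  -1ℤ *ℤ (X+ (a +ℤ + t) · sign n *ₚ arithProd t (a +ℤ + t) n) j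
    ≡⟨ cong (-1ℤ *ℤ_) (X+·-*ₚ _ (sign n) _ j) ⟩
  -1ℤ *ℤ (sign n *ℤ (X+ (a +ℤ + t) · arithProd t (a +ℤ + t) n) j)
    ≡⟨ lemma′ (sign n) _ ⟩
  sign (suc n) *ℤ (X+ (a +ℤ + t) · arithProd t (a +ℤ + t) n) j
    ≡⟨ cong (sign (suc n) *ℤ_) (arithProd-peel t a n j) ⟨
  sign (suc n) *ℤ arithProd t a (suc n) j ∎
  where
  b : ℤ
  b = - ((a +ℤ + t) +ℤ + (t * suc n))
  lemma : ∀ x y → - (x +ℤ y) +ℤ y ≡ - x
  lemma = solve-∀
  lemma′ : ∀ s x → -1ℤ *ℤ (s *ℤ x) ≡ (- s) *ℤ x
  lemma′ = solve-∀

arithProd-centred : ∀ n → reflect (arithProd 2 (- + suc n) n) ≗ sign n *ₚ arithProd 2 (- + suc n) n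
arithProd-centred n j = begin
  reflect (arithProd 2 (- + suc n) n) j
    ≡⟨ cong (λ a → reflect (arithProd 2 a n) j) centre ⟨
  reflect (arithProd 2 (- (- + suc n +ℤ + (2 * suc n))) n) j
    ≡⟨ arithProd-reflect 2 (- + suc n) n j ⟩
  sign n *ℤ arithProd 2 (- + suc n) n j ∎
  where
  lemma : ∀ x → - (- x +ℤ (x +ℤ x)) ≡ - x
  lemma = solve-∀
  centre : - (- + suc n +ℤ + (2 * suc n)) ≡ - + suc n
  centre = trans (cong (λ m → - (- + suc n +ℤ + (suc n + m))) (ℕ.+-identityʳ (suc n)))
                 (trans (cong (λ x → - (- + suc n +ℤ x)) (ℤ.pos-+ (suc n) (suc n))) (lemma (+ suc n)))

stirling1-above : ∀ N k → N < k → stirling1 N k ≡ 0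
stirling1-above zero    (suc k) _ = refl
stirling1-above (suc N) (suc k) (s≤s N<k)
  rewrite stirling1-above N (suc k) (ℕ.m≤n⇒m≤1+n N<k) | stirling1-above N k N<k | ℕ.*-zeroʳ N = refl

-- The generating function Σ_k [M+1, k] t^(M+1-k) z^k divided by z = X + a.
stirlingPoly : ℕ → ℤ → ℕ → Poly
stirlingPoly t a M j = sumTo M (λ k → + (t ^ (M ∸ k) * stirling1 (suc M) (suc k)) *ℤ (X+ a ^ k) j)

stirlingPoly-suc : ∀ t a M → stirlingPoly t a (suc M) ≗ X+ (a +ℤ + (t * suc M)) · stirlingPoly t a M
stirlingPoly-suc t a M j = begin
  stirlingPoly t a (suc M) j
    ≡⟨ sumTo-cong (suc M) (λ k _ → recurrence k) ⟩
  sumTo (suc M) (λ k → u k +ℤ v k)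
    ≡⟨ sumTo-+ (suc M) u v ⟩
  sumTo (suc M) u +ℤ sumTo (suc M) v
    ≡⟨ cong₂ _+ℤ_ u-sum v-sum ⟩
  + (t * suc M) *ℤ S j +ℤ (X+ a · S) j
    ≡⟨ ℤ.+-comm (+ (t * suc M) *ℤ S j) ((X+ a · S) j) ⟩
  (X+ a · S) j +ℤ + (t * suc M) *ℤ S j
    ≡⟨ X+·-+ a (+ (t * suc M)) S j ⟨
  (X+ (a +ℤ + (t * suc M)) · S) j ∎
  where
  S : Poly
  S = stirlingPoly t a M
  s : ℕ → ℕ
  s = stirling1 (suc M)
  w u v : ℕ → ℤ
  w k = + (t ^ (M ∸ k) * s (suc k))
  u k = + (t ^ (suc M ∸ k) * (suc M * s (suc k))) *ℤ (X+ a ^ k) j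
  v k = + (t ^ (suc M ∸ k) * s k) *ℤ (X+ a ^ k) j
  recurrence : ∀ k → + (t ^ (suc M ∸ k) * stirling1 (2 + M) (suc k)) *ℤ (X+ a ^ k) j ≡ u k +ℤ v k
  recurrence k = begin
    + (p * (suc M * s (suc k) + s k)) *ℤ E          ≡⟨ cong (λ m → + m *ℤ E) (ℕ.*-distribˡ-+ p (suc M * s (suc k)) (s k)) ⟩
    + (p * (suc M * s (suc k)) + p * s k) *ℤ E      ≡⟨ cong (_*ℤ E) (ℤ.pos-+ (p * (suc M * s (suc k))) (p * s k)) ⟩
    (+ (p * (suc M * s (suc k))) +ℤ + (p * s k)) *ℤ E ≡⟨ ℤ.*-distribʳ-+ E (+ (p * (suc M * s (suc k)))) (+ (p * s k)) ⟩
    u k +ℤ v k                                      ∎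
    where
    p : ℕ
    p = t ^ (suc M ∸ k)
    E : ℤ
    E = (X+ a ^ k) j
  u-sum : sumTo (suc M) u ≡ + (t * suc M) *ℤ S j
  u-sum = begin
    sumTo M u +ℤ u (suc M)  ≡⟨ cong (sumTo M u +ℤ_) u-last ⟩
    sumTo M u +ℤ 0ℤ         ≡⟨ ℤ.+-identityʳ _ ⟩
    sumTo M u               ≡⟨ sumTo-cong M u-factor ⟩
    sumTo M (λ k → + (t * suc M) *ℤ (w k *ℤ (X+ a ^ k) j))
                            ≡⟨ sumTo-*ˡ M (+ (t * suc M)) (λ k → w k *ℤ (X+ a ^ k) j) ⟩
    + (t * suc M) *ℤ S j    ∎
    where
    u-last : u (suc M) ≡ 0ℤ
    u-last rewrite stirling1-above (suc M) (2 + M) ℕ.≤-refl | ℕ.*-zeroʳ (suc M) | ℕ.*-zeroʳ (t ^ (M ∸ M)) = refl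
    u-factor : ∀ k → k ≤ M → u k ≡ + (t * suc M) *ℤ (w k *ℤ (X+ a ^ k) j)
    u-factor k k≤M = begin
      + (t ^ (suc M ∸ k) * (suc M * s (suc k))) *ℤ E
        ≡⟨ cong (λ e → + (t ^ e * (suc M * s (suc k))) *ℤ E) (ℕ.+-∸-assoc 1 k≤M) ⟩
      + (t * t ^ (M ∸ k) * (suc M * s (suc k))) *ℤ E
        ≡⟨ cong (λ m → + m *ℤ E) (lemma t (t ^ (M ∸ k)) (suc M) (s (suc k))) ⟩
      + (t * suc M * (t ^ (M ∸ k) * s (suc k))) *ℤ E
        ≡⟨ cong (_*ℤ E) (ℤ.pos-* (t * suc M) (t ^ (M ∸ k) * s (suc k))) ⟩
      + (t * suc M) *ℤ w k *ℤ E
        ≡⟨ ℤ.*-assoc (+ (t * suc M)) (w k) E ⟩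
      + (t * suc M) *ℤ (w k *ℤ E) ∎
      where
      E : ℤ
      E = (X+ a ^ k) j
      lemma : ∀ t p m s → t * p * (m * s) ≡ t * m * (p * s)
      lemma = ℕ-Solver.solve-∀
  v-sum : sumTo (suc M) v ≡ (X+ a · S) j
  v-sum = begin
    sumTo (suc M) v                                          ≡⟨ sumTo-suc M v ⟩
    v 0 +ℤ sumTo M (λ k → v (suc k))                         ≡⟨ cong (_+ℤ sumTo M (λ k → v (suc k))) v-first ⟩
    0ℤ +ℤ sumTo M (λ k → v (suc k))                          ≡⟨ ℤ.+-identityˡ _ ⟩
    sumTo M (λ k → v (suc k))                                ≡⟨ sumTo-cong M (λ k _ → X+·-*ₚ a (w k) (X+ a ^ k) j) ⟨
    sumTo M (λ k → (X+ a · w k *ₚ X+ a ^ k) j)               ≡⟨ sumTo-X+· M a (λ k → w k *ₚ X+ a ^ k) j ⟩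
    (X+ a · S) j                                             ∎
    where
    v-first : v 0 ≡ 0ℤ
    v-first rewrite ℕ.*-zeroʳ (t ^ suc M) = refl

stirlingPoly≗arithProd : ∀ t a M → stirlingPoly t a M ≗ arithProd t a M
stirlingPoly≗arithProd t a zero    j = ℤ.*-identityˡ (1ₚ j)
stirlingPoly≗arithProd t a (suc M) j =
  trans (stirlingPoly-suc t a M j) (X+·-cong _ (stirlingPoly≗arithProd t a M) j)

stirlingPoly-coeff : ∀ t m h j → stirlingPoly t (- + m) (h + j) j ≡
  sumTo h (λ r → sign r *ℤ + (t ^ (h ∸ r) * m ^ r * ((j + r) C j) * stirling1 (suc (h + j)) (suc (j + r))))
stirlingPoly-coeff t m h j = begin
  sumTo (h + j) f            ≡⟨ cong (λ L → sumTo L f) (ℕ.+-comm h j) ⟩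
  sumTo (j + h) f            ≡⟨ sumTo-drop j h f below-j ⟩
  sumTo h (λ r → f (j + r))  ≡⟨ sumTo-cong h (λ r _ → term r) ⟩
  sumTo h (λ r → sign r *ℤ + (t ^ (h ∸ r) * m ^ r * ((j + r) C j) * S (j + r))) ∎
  where
  S : ℕ → ℕ
  S k = stirling1 (suc (h + j)) (suc k)
  f : ℕ → ℤ
  f k = + (t ^ (h + j ∸ k) * S k) *ℤ (X+ (- + m) ^ k) j
  below-j : ∀ k → k < j → f k ≡ 0ℤ
  below-j k k<j = trans (cong (+ (t ^ (h + j ∸ k) * S k) *ℤ_) (X+^-coeff-above (- + m) k j k<j))
                        (ℤ.*-zeroʳ (+ (t ^ (h + j ∸ k) * S k)))
  rearrange : ∀ p q b s σ → + (p * s) *ℤ (+ b *ℤ (σ *ℤ + q)) ≡ σ *ℤ + (p * q * b * s)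
  rearrange p q b s σ = begin
    + (p * s) *ℤ (+ b *ℤ (σ *ℤ + q))        ≡⟨ cong (_*ℤ (+ b *ℤ (σ *ℤ + q))) (ℤ.pos-* p s) ⟩
    + p *ℤ + s *ℤ (+ b *ℤ (σ *ℤ + q))       ≡⟨ lemma (+ p) (+ q) (+ b) (+ s) σ ⟩
    σ *ℤ (+ p *ℤ + q *ℤ + b *ℤ + s)         ≡⟨ cong (σ *ℤ_) pos-*⁴ ⟨
    σ *ℤ + (p * q * b * s)                  ∎
    where
    lemma : ∀ p q b s σ → p *ℤ s *ℤ (b *ℤ (σ *ℤ q)) ≡ σ *ℤ (p *ℤ q *ℤ b *ℤ s)
    lemma = solve-∀
    pos-*⁴ : + (p * q * b * s) ≡ + p *ℤ + q *ℤ + b *ℤ + s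
    pos-*⁴ = trans (ℤ.pos-* (p * q * b) s)
                   (cong (_*ℤ + s) (trans (ℤ.pos-* (p * q) b) (cong (_*ℤ + b) (ℤ.pos-* p q))))
  term : ∀ r → f (j + r) ≡ sign r *ℤ + (t ^ (h ∸ r) * m ^ r * ((j + r) C j) * S (j + r))
  term r = begin
    + (t ^ (h + j ∸ (j + r)) * S (j + r)) *ℤ (X+ (- + m) ^ (j + r)) j
      ≡⟨ cong₂ (λ e x → + (t ^ e * S (j + r)) *ℤ x) h+j∸[j+r]≡h∸r (X+^-coeff (- + m) j r) ⟩
    + (t ^ (h ∸ r) * S (j + r)) *ℤ (+ ((j + r) C j) *ℤ (- + m) ^ℤ r)
      ≡⟨ cong (λ x → + (t ^ (h ∸ r) * S (j + r)) *ℤ (+ ((j + r) C j) *ℤ x)) ([-m]^r≡sign[r]*m^r m r) ⟩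
    + (t ^ (h ∸ r) * S (j + r)) *ℤ (+ ((j + r) C j) *ℤ (sign r *ℤ + (m ^ r)))
      ≡⟨ rearrange (t ^ (h ∸ r)) (m ^ r) ((j + r) C j) (S (j + r)) (sign r) ⟩
    sign r *ℤ + (t ^ (h ∸ r) * m ^ r * ((j + r) C j) * S (j + r)) ∎
    where
    h+j∸[j+r]≡h∸r : h + j ∸ (j + r) ≡ h ∸ r
    h+j∸[j+r]≡h∸r = trans (cong (_∸ (j + r)) (ℕ.+-comm h j)) (ℕ.[m+n]∸[m+o]≡n∸o j h r)

corollary1 : (n h : ℕ) → 1 ≤ n → (∃ λ k → h ≡ 2 * k + 1) → 1 ≤ h → h ≤ n ∸ 1 →
    sumTo h (λ r → sign r *ℤ (+ (2 ^ (h ∸ r) * n ^ r * ((n + r ∸ h ∸ 1) C (n ∸ h ∸ 1)) * stirling1 n (n ∸ h + r)))) ≡ 0ℤ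
corollary1 (suc m) h _ (k , refl) _ h≤m with ℕ.m≤n⇒∃[o]m+o≡n h≤m
... | j , refl = begin
  sumTo h _                              ≡⟨ sumTo-cong h (λ r _ → reindex r) ⟩
  sumTo h _                              ≡⟨ stirlingPoly-coeff 2 n h j ⟨
  stirlingPoly 2 (- + n) (h + j) j       ≡⟨ stirlingPoly≗arithProd 2 (- + n) (h + j) j ⟩
  arithProd 2 (- + n) (h + j) j          ≡⟨ reflect-parity-coeff (h + j) j (arithProd-centred (h + j)) (sign-odd k j) ⟩
  0ℤ                                     ∎
  where
  n : ℕ
  n = suc (h + j)
  n∸h≡1+j : n ∸ h ≡ suc j
  n∸h≡1+j = trans (cong (_∸ h) (sym (ℕ.+-suc h j))) (ℕ.m+n∸m≡n h (suc j))
  n+r∸h≡1+j+r : ∀ r → n + r ∸ h ≡ suc (j + r)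
  n+r∸h≡1+j+r r = trans (cong (_∸ h) n+r≡h+[1+j+r]) (ℕ.m+n∸m≡n h (suc (j + r)))
    where
    n+r≡h+[1+j+r] : n + r ≡ h + suc (j + r)
    n+r≡h+[1+j+r] = trans (cong suc (ℕ.+-assoc h j r)) (sym (ℕ.+-suc h (j + r)))
  reindex : ∀ r → sign r *ℤ + (2 ^ (h ∸ r) * n ^ r * ((n + r ∸ h ∸ 1) C (n ∸ h ∸ 1)) * stirling1 n (n ∸ h + r))
                ≡ sign r *ℤ + (2 ^ (h ∸ r) * n ^ r * ((j + r) C j) * stirling1 n (suc (j + r)))
  reindex r rewrite n+r∸h≡1+j+r r | n∸h≡1+j = refl
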